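{- Let $q,m,n$ be nonnegative integers with $m+n>0$. Then, as polynomials in $x$, $$\sum_{j=0}^{m+q}\binom{m+q}{j}(n+q+j)B_{n+q+j-1}(x)=-(-1)^{m+n}\sum_{k=0}^{n+q}\binom{n+q}{k}(m+q+k)B_{m+q+k-1}(-x).$$
   Context: The Bernoulli polynomials $B_n(x)$ are defined by $\frac{te^{xt}}{e^t-1}=\sum_{n\ge0}B_n(x)\frac{t^n}{n!}$. A summand whose numerical coefficient $(n+q+j)$ or $(m+q+k)$ equals $0$ (so that the index of $B$ would be $-1$) is interpreted as $0$. -}

module Defs where

open import Data.Nat using (ℕ; zero; suc)
import Data.Nat as ℕ
open import Data.Nat.Combinatorics using (_C_)
open import Data.Integer using (+_)
open import Data.Rational using (ℚ; 0ℚ; 1ℚ; _+_; _*_; -_; _/_)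
open import Data.Bool using (true; false)
open import Data.List using (List; []; _∷_; _++_; [_])

ℕ→ℚ : ℕ → ℚ
ℕ→ℚ n = + n / 1

sgn : ℕ → ℚ
sgn zero = 1ℚ
sgn (suc n) = - sgn n

Σ≤ : ℕ → (ℕ → ℚ) → ℚ
Σ≤ zero f = f 0
Σ≤ (suc n) f = Σ≤ n f + f (suc n)

Σ< : ℕ → (ℕ → ℚ) → ℚ
Σ< zero f = 0ℚ
Σ< (suc n) f = Σ< n f + f n

at : List ℚ → ℕ → ℚ
at [] _ = 0ℚ
at (x ∷ xs) zero = x
at (x ∷ xs) (suc k) = at xs k

-- List [B_0, ..., B_{n-1}] of Bernoulli numbers, via the standard recursion
-- Σ_{k=0}^{n} C(n+1,k) B_k = 0 (n ≥ 1), B_0 = 1, equivalent to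
-- t/(e^t-1) = Σ B_n t^n/n!  (so B_1 = -1/2).
bernList : ℕ → List ℚ
bernList zero = []
bernList (suc n) = bs ++ [ next n ]
  where
  bs = bernList n
  next : ℕ → ℚ
  next zero = 1ℚ
  next (suc n') =
    - ((+ 1 / suc (suc n')) * Σ< (suc n') (λ k → ℕ→ℚ (suc (suc n') C k) * at bs k))

bern : ℕ → ℚ
bern n = at (bernList (suc n)) n

-- Polynomials over ℚ in one variable, represented by their coefficient
-- sequence (coefficient of x^i); equality "as polynomials" = coefficientwise.
Poly : Set
Poly = ℕ → ℚ

bernPoly : ℕ → Poly
bernPoly n i with i ℕ.≤ᵇ n
... | true = ℕ→ℚ (n C i) * bern (n ℕ.∸ i)
... | false = 0ℚ

infixr 7 _·_
_·_ : ℚ → Poly → Poly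
(c · p) i = c * p i

neg-x : Poly → Poly
neg-x p i = sgn i * p i

ΣP≤ : ℕ → (ℕ → Poly) → Poly
ΣP≤ n f i = Σ≤ n (λ j → f j i)

-- N · B_{N-1}(x), interpreted as 0 when N = 0 (convention of the paper).
NB : ℕ → Poly
NB zero = λ _ → 0ℚ
NB (suc N) = ℕ→ℚ (suc N) · bernPoly N

module Submission where

-- Write  S[M, f, a] = Σ_{j ≤ M} C(M,j) f(a+j).  Pascal's rule gives
-- S[M+1, f, a] = S[M, f, a] + S[M, f, a+1]; hence for any two sequences
-- P, Q satisfying the "reflection" relation  P(a) = -(-1)^a S[a, Q, 0]
-- one gets by induction on M the two-parameter identity
--     S[M, P, a] = -(-1)^{M+a} S[a, Q, M].
-- The theorem is this identity for P(N) = N B_{N-1}(x), Q(N) = N B_{N-1}(-x),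
-- M = m+q, a = n+q (the parities of M+a and m+n agree).
--
-- The reflection relation for N B_{N-1} comes from the classical identity
-- Σ_k C(N,k) B_k(x) = (-1)^N B_N(-x), i.e. B_N(x+1) = (-1)^N B_N(-x).  On
-- coefficients it reduces to  Σ_r C(d,r) B_r = (-1)^d B_d,  which follows
-- because (-1)^k Σ_r C(k,r) B_r satisfies the recurrence defining the B_k
-- (this uses binomial inversion) and that recurrence has a unique solution.

open import Defs
open import Data.Nat using (ℕ; _<_)
import Data.Nat as ℕ
open import Data.Nat.Combinatorics using (_C_)
open import Data.Rational using (-_)
open import Relation.Binary.PropositionalEquality using (_≡_)

module BinomialIdentities where
  open import Data.Nat using (zero; suc; _+_; _*_; z≤n; s≤s)
  import Data.Nat.Properties as ℕP
  open import Data.Nat.Combinatorics using (nCn≡1; nC1≡n; nCk+nC[k+1]≡[n+1]C[k+1]; k>n⇒nCk≡0)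
  open import Data.Nat.Solver using (module +-*-Solver)
  open import Relation.Binary.PropositionalEquality using (refl; sym; trans; cong; cong₂; module ≡-Reasoning)
  open +-*-Solver
  open ≡-Reasoning

  C-[1+n]-n : ∀ n → suc n C n ≡ suc n
  C-[1+n]-n zero = refl
  C-[1+n]-n (suc n) = trans (sym (nCk+nC[k+1]≡[n+1]C[k+1] (suc n) n))
    (trans (cong₂ _+_ (C-[1+n]-n n) (nCn≡1 (suc n))) (ℕP.+-comm (suc n) 1))

  absorption : ∀ n k → suc k * (suc n C suc k) ≡ suc n * (n C k)
  absorption zero zero = refl
  absorption zero (suc k) =
    trans (cong (suc (suc k) *_) (k>n⇒nCk≡0 {1} {suc (suc k)} (s≤s (s≤s z≤n)))) (ℕP.*-zeroʳ (suc (suc k)))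
  absorption (suc n) zero =
    trans (ℕP.*-identityˡ (suc (suc n) C 1)) (trans (nC1≡n (suc (suc n))) (sym (ℕP.*-identityʳ (suc (suc n)))))
  absorption (suc n) (suc k) = begin
    (2 + k) * (suc (suc n) C (2 + k))
      ≡⟨ cong ((2 + k) *_) (sym (nCk+nC[k+1]≡[n+1]C[k+1] (suc n) (suc k))) ⟩
    (2 + k) * (a + b)
      ≡⟨ solve 3 (λ k a b → (con 2 :+ k) :* (a :+ b)
                      := ((con 1 :+ k) :* a :+ a) :+ (con 2 :+ k) :* b) refl k a b ⟩
    ((1 + k) * a + a) + (2 + k) * b
      ≡⟨ cong₂ (λ x y → (x + a) + y) (absorption n k) (absorption n (suc k)) ⟩
    ((1 + n) * c + a) + (1 + n) * d
      ≡⟨ solve 4 (λ n a c d → ((con 1 :+ n) :* c :+ a) :+ (con 1 :+ n) :* d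
                      := (con 1 :+ n) :* (c :+ d) :+ a) refl n a c d ⟩
    (1 + n) * (c + d) + a
      ≡⟨ cong (λ x → (1 + n) * x + a) (nCk+nC[k+1]≡[n+1]C[k+1] n k) ⟩
    (1 + n) * a + a
      ≡⟨ solve 2 (λ n a → (con 1 :+ n) :* a :+ a := (con 2 :+ n) :* a) refl n a ⟩
    (2 + n) * a ∎
    where
    a = suc n C suc k
    b = suc n C suc (suc k)
    c = n C k
    d = n C suc k

  subset-of-subset : ∀ i d r → ((i + d) C (i + r)) * ((i + r) C i) ≡ ((i + d) C i) * (d C r)
  subset-of-subset zero d r = trans (ℕP.*-identityʳ (d C r)) (sym (ℕP.*-identityˡ (d C r)))
  subset-of-subset (suc i) d r = ℕP.*-cancelˡ-≡ _ _ (suc i * suc (i + r)) (begin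
    (x * y) * (A * B)  ≡⟨ solve 4 (λ x y a b → (x :* y) :* (a :* b) := (y :* a) :* (x :* b)) refl x y A B ⟩
    (y * A) * (x * B)  ≡⟨ cong₂ _*_ (absorption (i + d) (i + r)) (absorption (i + r) i) ⟩
    (z * P) * (y * Q)  ≡⟨ solve 4 (λ z y p q → (z :* p) :* (y :* q) := y :* (z :* (p :* q))) refl z y P Q ⟩
    y * (z * (P * Q))  ≡⟨ cong (λ t → y * (z * t)) (subset-of-subset i d r) ⟩
    y * (z * (D * E))  ≡⟨ solve 4 (λ z y d e → y :* (z :* (d :* e)) := y :* ((z :* d) :* e)) refl z y D E ⟩
    y * ((z * D) * E)  ≡⟨ cong (λ t → y * (t * E)) (sym (absorption (i + d) i)) ⟩
    y * ((x * F) * E)  ≡⟨ solve 4 (λ x y f e → y :* ((x :* f) :* e) := (x :* y) :* (f :* e)) refl x y F E ⟩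
    (x * y) * (F * E)  ∎)
    where
    x = suc i
    y = suc (i + r)
    z = suc (i + d)
    A = suc (i + d) C suc (i + r)
    B = suc (i + r) C suc i
    P = (i + d) C (i + r)
    Q = (i + r) C i
    D = (i + d) C i
    E = d C r
    F = suc (i + d) C suc i

open BinomialIdentities

open import Data.Nat using (zero; suc; _≤_; z≤n; s≤s)
import Data.Nat.Properties as ℕP
open import Data.Nat.Induction using (<-rec)
open import Data.Nat.Combinatorics
  using (nCn≡1; nCk+nC[k+1]≡[n+1]C[k+1]; k>n⇒nCk≡0)
open import Data.Nat.Combinatorics.Base using (_C′_)
open import Data.Nat.Coprimality using (1-coprimeTo) renaming (sym to coprime-sym)
import Data.Integer as ℤ
import Data.Integer.Properties as ℤP
open import Data.Rational using (ℚ; mkℚ; 0ℚ; 1ℚ; _+_; _*_; _/_; toℚᵘ)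
open import Data.Rational.Properties
import Data.Rational.Unnormalised as U
import Data.Rational.Unnormalised.Properties as UP
open import Data.Rational.Solver using (module +-*-Solver)
open import Algebra.Properties.Group +-0-group using (∙-cancelˡ)
open import Data.Bool using (true; false; T; if_then_else_)
open import Data.List using (List; []; _∷_; _++_; [_]; length)
open import Data.List.Properties using (length-++)
open import Data.Product using (_,_)
open import Data.Sum using (inj₁; inj₂)
open import Relation.Nullary using (contradiction)
open import Relation.Binary.PropositionalEquality
  using (refl; sym; trans; cong; cong₂; subst; module ≡-Reasoning)

open +-*-Solver
open ≡-Reasoning

toℚᵘ-ℕ→ℚ : ∀ n → toℚᵘ (ℕ→ℚ n) ≡ U.mkℚᵘ (ℤ.+ n) 0
toℚᵘ-ℕ→ℚ n = cong toℚᵘ (normalize-coprime (coprime-sym (1-coprimeTo n)))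

-- ℕ→ℚ is additive and multiplicative; both are checked in ℚᵘ, where the
-- operations on denominators 1 are transparent.
ℕ→ℚ-+ : ∀ a b → ℕ→ℚ (a ℕ.+ b) ≡ ℕ→ℚ a + ℕ→ℚ b
ℕ→ℚ-+ a b = toℚᵘ-injective (UP.≃-trans (UP.≃-reflexive (toℚᵘ-ℕ→ℚ (a ℕ.+ b)))
  (UP.≃-trans denominator-one (UP.≃-sym (UP.≃-trans (toℚᵘ-homo-+ (ℕ→ℚ a) (ℕ→ℚ b))
    (UP.≃-reflexive (cong₂ U._+_ (toℚᵘ-ℕ→ℚ a) (toℚᵘ-ℕ→ℚ b)))))))
  where
  denominator-one : U.mkℚᵘ (ℤ.+ (a ℕ.+ b)) 0 U.≃ (U.mkℚᵘ (ℤ.+ a) 0 U.+ U.mkℚᵘ (ℤ.+ b) 0)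
  denominator-one = U.*≡* (cong (ℤ._* ℤ.+ 1)
    (sym (cong₂ ℤ._+_ (ℤP.*-identityʳ (ℤ.+ a)) (ℤP.*-identityʳ (ℤ.+ b)))))

ℕ→ℚ-* : ∀ a b → ℕ→ℚ (a ℕ.* b) ≡ ℕ→ℚ a * ℕ→ℚ b
ℕ→ℚ-* a b = toℚᵘ-injective (UP.≃-trans (UP.≃-reflexive (toℚᵘ-ℕ→ℚ (a ℕ.* b)))
  (UP.≃-trans denominator-one (UP.≃-sym (UP.≃-trans (toℚᵘ-homo-* (ℕ→ℚ a) (ℕ→ℚ b))
    (UP.≃-reflexive (cong₂ U._*_ (toℚᵘ-ℕ→ℚ a) (toℚᵘ-ℕ→ℚ b)))))))
  where
  denominator-one : U.mkℚᵘ (ℤ.+ (a ℕ.* b)) 0 U.≃ (U.mkℚᵘ (ℤ.+ a) 0 U.* U.mkℚᵘ (ℤ.+ b) 0)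
  denominator-one = U.*≡* (cong (ℤ._* ℤ.+ 1) (ℤP.pos-* a b))

ℕ→ℚ-inverse : ∀ k → ℕ→ℚ (suc k) * (ℤ.+ 1 / suc k) ≡ 1ℚ
ℕ→ℚ-inverse k =
  trans (cong₂ _*_ (normalize-coprime (coprime-sym (1-coprimeTo (suc k))))
                   (normalize-coprime (1-coprimeTo (suc k))))
        (*-inverseʳ (mkℚ (ℤ.+ suc k) 0 (coprime-sym (1-coprimeTo (suc k)))))

ℕ→ℚ-cancel : ∀ k {x y} → ℕ→ℚ (suc k) * x ≡ ℕ→ℚ (suc k) * y → x ≡ y
ℕ→ℚ-cancel k {x} {y} eq = begin
  x                   ≡⟨ sym (*-identityˡ x) ⟩
  1ℚ * x              ≡⟨ cong (_* x) (sym (ℕ→ℚ-inverse k)) ⟩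
  (c * c⁻¹) * x       ≡⟨ solve 3 (λ c c⁻¹ x → (c :* c⁻¹) :* x := c⁻¹ :* (c :* x)) refl c c⁻¹ x ⟩
  c⁻¹ * (c * x)       ≡⟨ cong (c⁻¹ *_) eq ⟩
  c⁻¹ * (c * y)       ≡⟨ solve 3 (λ c c⁻¹ y → c⁻¹ :* (c :* y) := (c :* c⁻¹) :* y) refl c c⁻¹ y ⟩
  (c * c⁻¹) * y       ≡⟨ cong (_* y) (ℕ→ℚ-inverse k) ⟩
  1ℚ * y              ≡⟨ *-identityˡ y ⟩
  y                   ∎
  where
  c = ℕ→ℚ (suc k)
  c⁻¹ = ℤ.+ 1 / suc k

sgn-+ : ∀ a b → sgn (a ℕ.+ b) ≡ sgn a * sgn b
sgn-+ zero b = sym (*-identityˡ (sgn b))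
sgn-+ (suc a) b = trans (cong -_ (sgn-+ a b)) (neg-distribˡ-* (sgn a) (sgn b))

sgn² : ∀ a → sgn a * sgn a ≡ 1ℚ
sgn² zero = refl
sgn² (suc a) = trans (solve 1 (λ s → (:- s) :* (:- s) := s :* s) refl (sgn a)) (sgn² a)

sgn-cancel : ∀ i d → sgn (i ℕ.+ d) * sgn i ≡ sgn d
sgn-cancel i d = begin
  sgn (i ℕ.+ d) * sgn i     ≡⟨ cong (_* sgn i) (sgn-+ i d) ⟩
  (sgn i * sgn d) * sgn i   ≡⟨ solve 2 (λ s t → (s :* t) :* s := (s :* s) :* t) refl (sgn i) (sgn d) ⟩
  (sgn i * sgn i) * sgn d   ≡⟨ cong (_* sgn d) (sgn² i) ⟩
  1ℚ * sgn d                ≡⟨ *-identityˡ (sgn d) ⟩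
  sgn d                     ∎

sgn-parity : ∀ m n q → sgn (m ℕ.+ q ℕ.+ (n ℕ.+ q)) ≡ sgn (m ℕ.+ n)
sgn-parity m n q = begin
  sgn (m ℕ.+ q ℕ.+ (n ℕ.+ q))
    ≡⟨ trans (sgn-+ (m ℕ.+ q) (n ℕ.+ q)) (cong₂ _*_ (sgn-+ m q) (sgn-+ n q)) ⟩
  (sgn m * sgn q) * (sgn n * sgn q)
    ≡⟨ solve 3 (λ a b c → (a :* c) :* (b :* c) := (a :* b) :* (c :* c)) refl (sgn m) (sgn n) (sgn q) ⟩
  (sgn m * sgn n) * (sgn q * sgn q)
    ≡⟨ cong₂ _*_ (sym (sgn-+ m n)) (sgn² q) ⟩
  sgn (m ℕ.+ n) * 1ℚ
    ≡⟨ *-identityʳ _ ⟩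
  sgn (m ℕ.+ n) ∎

Σ-cong : ∀ n {f g : ℕ → ℚ} → (∀ k → k ≤ n → f k ≡ g k) → Σ≤ n f ≡ Σ≤ n g
Σ-cong zero eq = eq 0 z≤n
Σ-cong (suc n) eq =
  cong₂ _+_ (Σ-cong n (λ k k≤n → eq k (ℕP.m≤n⇒m≤1+n k≤n))) (eq (suc n) ℕP.≤-refl)

Σ-zero : ∀ n {f : ℕ → ℚ} → (∀ k → k ≤ n → f k ≡ 0ℚ) → Σ≤ n f ≡ 0ℚ
Σ-zero n eq = trans (Σ-cong n eq) (Σ-const-zero n)
  where
  Σ-const-zero : ∀ n → Σ≤ n (λ _ → 0ℚ) ≡ 0ℚ
  Σ-const-zero zero = refl
  Σ-const-zero (suc n) = cong (_+ 0ℚ) (Σ-const-zero n)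

Σ-+ : ∀ n (f g : ℕ → ℚ) → Σ≤ n (λ k → f k + g k) ≡ Σ≤ n f + Σ≤ n g
Σ-+ zero f g = refl
Σ-+ (suc n) f g = trans (cong (_+ (f (suc n) + g (suc n))) (Σ-+ n f g))
  (solve 4 (λ a b c d → (a :+ b) :+ (c :+ d) := (a :+ c) :+ (b :+ d)) refl
    (Σ≤ n f) (Σ≤ n g) (f (suc n)) (g (suc n)))

Σ-scale : ∀ n c (f : ℕ → ℚ) → Σ≤ n (λ k → c * f k) ≡ c * Σ≤ n f
Σ-scale zero c f = refl
Σ-scale (suc n) c f =
  trans (cong (_+ (c * f (suc n))) (Σ-scale n c f)) (sym (*-distribˡ-+ c (Σ≤ n f) (f (suc n))))

Σ-scaleʳ : ∀ n c (f : ℕ → ℚ) → Σ≤ n (λ k → f k * c) ≡ Σ≤ n f * c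
Σ-scaleʳ n c f =
  trans (Σ-cong n (λ k _ → *-comm (f k) c)) (trans (Σ-scale n c f) (*-comm c (Σ≤ n f)))

Σ-neg : ∀ n (f : ℕ → ℚ) → Σ≤ n (λ k → - f k) ≡ - Σ≤ n f
Σ-neg zero f = refl
Σ-neg (suc n) f =
  trans (cong (_+ (- f (suc n))) (Σ-neg n f)) (sym (neg-distrib-+ (Σ≤ n f) (f (suc n))))

Σ-shift : ∀ n (f : ℕ → ℚ) → Σ≤ (suc n) f ≡ f 0 + Σ≤ n (λ k → f (suc k))
Σ-shift zero f = refl
Σ-shift (suc n) f = trans (cong (_+ f (suc (suc n))) (Σ-shift n f))
  (+-assoc (f 0) (Σ≤ n (λ k → f (suc k))) (f (suc (suc n))))

Σ-swap : ∀ n m (f : ℕ → ℕ → ℚ) →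
  Σ≤ n (λ k → Σ≤ m (λ l → f k l)) ≡ Σ≤ m (λ l → Σ≤ n (λ k → f k l))
Σ-swap zero m f = refl
Σ-swap (suc n) m f = trans (cong (_+ Σ≤ m (λ l → f (suc n) l)) (Σ-swap n m f))
  (sym (Σ-+ m (λ l → Σ≤ n (λ k → f k l)) (λ l → f (suc n) l)))

Σ-extend : ∀ k d {g : ℕ → ℚ} → (∀ l → k < l → g l ≡ 0ℚ) → Σ≤ (k ℕ.+ d) g ≡ Σ≤ k g
Σ-extend k zero {g} _ = cong (λ x → Σ≤ x g) (ℕP.+-identityʳ k)
Σ-extend k (suc d) {g} vanish = begin
  Σ≤ (k ℕ.+ suc d) g                  ≡⟨ cong (λ x → Σ≤ x g) (ℕP.+-suc k d) ⟩
  Σ≤ (k ℕ.+ d) g + g (suc (k ℕ.+ d))  ≡⟨ cong₂ _+_ (Σ-extend k d vanish) (vanish _ (s≤s (ℕP.m≤m+n k d))) ⟩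
  Σ≤ k g + 0ℚ                         ≡⟨ +-identityʳ _ ⟩
  Σ≤ k g                              ∎

Σ-drop : ∀ i d {f : ℕ → ℚ} → (∀ k → k < i → f k ≡ 0ℚ) → Σ≤ (i ℕ.+ d) f ≡ Σ≤ d (λ r → f (i ℕ.+ r))
Σ-drop zero d _ = refl
Σ-drop (suc i) d {f} vanish = begin
  Σ≤ (suc (i ℕ.+ d)) f                      ≡⟨ Σ-shift (i ℕ.+ d) f ⟩
  f 0 + Σ≤ (i ℕ.+ d) (λ k → f (suc k))
    ≡⟨ cong₂ _+_ (vanish 0 (s≤s z≤n)) (Σ-drop i d (λ k k<i → vanish (suc k) (s≤s k<i))) ⟩
  0ℚ + Σ≤ d (λ r → f (suc (i ℕ.+ r)))      ≡⟨ +-identityˡ _ ⟩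
  Σ≤ d (λ r → f (suc i ℕ.+ r))              ∎

Σ<⇒Σ≤ : ∀ n (f : ℕ → ℚ) → Σ< (suc n) f ≡ Σ≤ n f
Σ<⇒Σ≤ zero f = +-identityˡ _
Σ<⇒Σ≤ (suc n) f = cong (_+ f (suc n)) (Σ<⇒Σ≤ n f)

δ : ℕ → ℕ → ℚ
δ zero zero = 1ℚ
δ zero (suc _) = 0ℚ
δ (suc _) zero = 0ℚ
δ (suc n) (suc l) = δ n l

Σ-δ : ∀ n (f : ℕ → ℚ) → Σ≤ n (λ l → f l * δ n l) ≡ f n
Σ-δ zero f = *-identityʳ (f 0)
Σ-δ (suc n) f = begin
  Σ≤ n (λ l → f l * δ (suc n) l) + f (suc n) * δ n n
    ≡⟨ cong₂ _+_ (Σ-zero n (λ l l≤n → trans (cong (f l *_) (δ-below (suc n) l (s≤s l≤n))) (*-zeroʳ (f l))))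
                 (trans (cong (f (suc n) *_) (δ-diagonal n)) (*-identityʳ (f (suc n)))) ⟩
  0ℚ + f (suc n)  ≡⟨ +-identityˡ (f (suc n)) ⟩
  f (suc n)       ∎
  where
  δ-diagonal : ∀ n → δ n n ≡ 1ℚ
  δ-diagonal zero = refl
  δ-diagonal (suc n) = δ-diagonal n
  δ-below : ∀ n l → l < n → δ n l ≡ 0ℚ
  δ-below (suc n) zero _ = refl
  δ-below (suc n) (suc l) (s≤s l<n) = δ-below n l l<n

-- Binomial sums and binomial inversion.

pascalℚ : ∀ n k → ℕ→ℚ (suc n C suc k) ≡ ℕ→ℚ (n C k) + ℕ→ℚ (n C suc k)
pascalℚ n k = trans (cong ℕ→ℚ (sym (nCk+nC[k+1]≡[n+1]C[k+1] n k))) (ℕ→ℚ-+ (n C k) (n C suc k))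

absorptionℚ : ∀ n k → ℕ→ℚ (suc k) * ℕ→ℚ (suc n C suc k) ≡ ℕ→ℚ (suc n) * ℕ→ℚ (n C k)
absorptionℚ n k =
  trans (sym (ℕ→ℚ-* (suc k) (suc n C suc k))) (trans (cong ℕ→ℚ (absorption n k)) (ℕ→ℚ-* (suc n) (n C k)))

pascalΣ : ∀ n (g : ℕ → ℚ) →
  Σ≤ (suc n) (λ k → ℕ→ℚ (suc n C k) * g k)
    ≡ Σ≤ n (λ k → ℕ→ℚ (n C k) * g k) + Σ≤ n (λ k → ℕ→ℚ (n C k) * g (suc k))
pascalΣ n g = begin
  Σ≤ (suc n) (λ k → ℕ→ℚ (suc n C k) * g k)    ≡⟨ Σ-shift n _ ⟩
  g₀ + Σ≤ n (λ k → ℕ→ℚ (suc n C suc k) * g (suc k))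
    ≡⟨ cong (g₀ +_) (trans (Σ-cong n (λ k _ → split k)) (Σ-+ n _ _)) ⟩
  g₀ + (A + B)                                 ≡⟨ solve 3 (λ x a b → x :+ (a :+ b) := (x :+ b) :+ a) refl g₀ A B ⟩
  (g₀ + B) + A                                 ≡⟨ cong (_+ A) (sym (Σ-shift n _)) ⟩
  Σ≤ (suc n) (λ k → ℕ→ℚ (n C k) * g k) + A
    ≡⟨ cong (λ x → (Σ≤ n (λ k → ℕ→ℚ (n C k) * g k) + x) + A)
            (trans (cong (λ c → ℕ→ℚ c * g (suc n)) (k>n⇒nCk≡0 {n} ℕP.≤-refl)) (*-zeroˡ (g (suc n)))) ⟩
  (Σ≤ n (λ k → ℕ→ℚ (n C k) * g k) + 0ℚ) + A
    ≡⟨ cong (_+ A) (+-identityʳ (Σ≤ n (λ k → ℕ→ℚ (n C k) * g k))) ⟩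
  Σ≤ n (λ k → ℕ→ℚ (n C k) * g k) + A           ∎
  where
  g₀ = ℕ→ℚ 1 * g 0
  A = Σ≤ n (λ k → ℕ→ℚ (n C k) * g (suc k))
  B = Σ≤ n (λ k → ℕ→ℚ (n C suc k) * g (suc k))
  split : ∀ k → ℕ→ℚ (suc n C suc k) * g (suc k)
              ≡ ℕ→ℚ (n C k) * g (suc k) + ℕ→ℚ (n C suc k) * g (suc k)
  split k = trans (cong (_* g (suc k)) (pascalℚ n k)) (*-distribʳ-+ (g (suc k)) (ℕ→ℚ (n C k)) (ℕ→ℚ (n C suc k)))

binomialTransform : (ℕ → ℚ) → ℕ → ℚ
binomialTransform a k = Σ≤ k (λ l → ℕ→ℚ (k C l) * a l)

alternating : ℕ → ℕ → ℚ
alternating n l = Σ≤ n (λ k → ℕ→ℚ (n C k) * (sgn k * ℕ→ℚ (k C l)))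

alternating-step : ∀ n l → alternating (suc n) l
  ≡ alternating n l + - Σ≤ n (λ k → ℕ→ℚ (n C k) * (sgn k * ℕ→ℚ (suc k C l)))
alternating-step n l = trans (pascalΣ n (λ k → sgn k * ℕ→ℚ (k C l)))
  (cong (alternating n l +_) (trans (Σ-cong n (λ k _ → flip-sign k)) (Σ-neg n _)))
  where
  flip-sign : ∀ k → ℕ→ℚ (n C k) * (sgn (suc k) * ℕ→ℚ (suc k C l))
                  ≡ - (ℕ→ℚ (n C k) * (sgn k * ℕ→ℚ (suc k C l)))
  flip-sign k = solve 3 (λ c s d → c :* ((:- s) :* d) := :- (c :* (s :* d))) refl
    (ℕ→ℚ (n C k)) (sgn k) (ℕ→ℚ (suc k C l))

alternating-δ : ∀ n l → alternating n l ≡ sgn n * δ n l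
alternating-δ zero zero = refl
alternating-δ zero (suc l) = refl
alternating-δ (suc n) zero = begin
  alternating (suc n) 0                          ≡⟨ alternating-step n 0 ⟩
  alternating n 0 + - alternating n 0            ≡⟨ +-inverseʳ (alternating n 0) ⟩
  0ℚ                                             ≡⟨ sym (*-zeroʳ (sgn (suc n))) ⟩
  sgn (suc n) * δ (suc n) 0                      ∎
alternating-δ (suc n) (suc l) = begin
  alternating (suc n) (suc l)                    ≡⟨ alternating-step n (suc l) ⟩
  alternating n (suc l) + - Σ≤ n (λ k → ℕ→ℚ (n C k) * (sgn k * ℕ→ℚ (suc k C suc l)))
    ≡⟨ cong (λ x → alternating n (suc l) + - x) (trans (Σ-cong n (λ k _ → split k)) (Σ-+ n _ _)) ⟩
  alternating n (suc l) + - (alternating n l + alternating n (suc l))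
    ≡⟨ solve 2 (λ x y → y :+ (:- (x :+ y)) := :- x) refl (alternating n l) (alternating n (suc l)) ⟩
  - alternating n l                              ≡⟨ cong -_ (alternating-δ n l) ⟩
  - (sgn n * δ n l)                              ≡⟨ neg-distribˡ-* (sgn n) (δ n l) ⟩
  sgn (suc n) * δ (suc n) (suc l)                ∎
  where
  split : ∀ k → ℕ→ℚ (n C k) * (sgn k * ℕ→ℚ (suc k C suc l))
    ≡ ℕ→ℚ (n C k) * (sgn k * ℕ→ℚ (k C l)) + ℕ→ℚ (n C k) * (sgn k * ℕ→ℚ (k C suc l))
  split k = trans (cong (λ x → ℕ→ℚ (n C k) * (sgn k * x)) (pascalℚ k l))
    (solve 4 (λ c s d e → c :* (s :* (d :+ e)) := c :* (s :* d) :+ c :* (s :* e)) refl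
      (ℕ→ℚ (n C k)) (sgn k) (ℕ→ℚ (k C l)) (ℕ→ℚ (k C suc l)))

binomial-inversion : ∀ a n →
  Σ≤ n (λ k → ℕ→ℚ (n C k) * (sgn k * binomialTransform a k)) ≡ sgn n * a n
binomial-inversion a n = begin
  Σ≤ n (λ k → ℕ→ℚ (n C k) * (sgn k * binomialTransform a k))
    ≡⟨ Σ-cong n (λ k k≤n → expand k k≤n) ⟩
  Σ≤ n (λ k → Σ≤ n (λ l → entry k l * a l))     ≡⟨ Σ-swap n n _ ⟩
  Σ≤ n (λ l → Σ≤ n (λ k → entry k l * a l))     ≡⟨ Σ-cong n (λ l _ → collect l) ⟩
  Σ≤ n (λ l → (sgn n * a l) * δ n l)           ≡⟨ Σ-δ n (λ l → sgn n * a l) ⟩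
  sgn n * a n                                   ∎
  where
  entry : ℕ → ℕ → ℚ
  entry k l = ℕ→ℚ (n C k) * (sgn k * ℕ→ℚ (k C l))
  -- The inner sum runs up to k, but C(k,l) = 0 for l > k extends it to n.
  widen : ∀ k → k ≤ n → binomialTransform a k ≡ Σ≤ n (λ l → ℕ→ℚ (k C l) * a l)
  widen k k≤n with ℕP.m≤n⇒∃[o]m+o≡n k≤n
  ... | o , refl = sym (Σ-extend k o (λ l k<l →
    trans (cong (λ c → ℕ→ℚ c * a l) (k>n⇒nCk≡0 k<l)) (*-zeroˡ (a l))))
  expand : ∀ k → k ≤ n →
    ℕ→ℚ (n C k) * (sgn k * binomialTransform a k) ≡ Σ≤ n (λ l → entry k l * a l)
  expand k k≤n = begin
    ℕ→ℚ (n C k) * (sgn k * binomialTransform a k)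
      ≡⟨ cong (λ x → ℕ→ℚ (n C k) * (sgn k * x)) (widen k k≤n) ⟩
    ℕ→ℚ (n C k) * (sgn k * Σ≤ n (λ l → ℕ→ℚ (k C l) * a l))
      ≡⟨ cong (ℕ→ℚ (n C k) *_) (sym (Σ-scale n (sgn k) _)) ⟩
    ℕ→ℚ (n C k) * Σ≤ n (λ l → sgn k * (ℕ→ℚ (k C l) * a l))
      ≡⟨ sym (Σ-scale n (ℕ→ℚ (n C k)) _) ⟩
    Σ≤ n (λ l → ℕ→ℚ (n C k) * (sgn k * (ℕ→ℚ (k C l) * a l)))
      ≡⟨ Σ-cong n (λ l _ → solve 4 (λ c s d x → c :* (s :* (d :* x)) := (c :* (s :* d)) :* x) refl
                              (ℕ→ℚ (n C k)) (sgn k) (ℕ→ℚ (k C l)) (a l)) ⟩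
    Σ≤ n (λ l → entry k l * a l) ∎
  collect : ∀ l → Σ≤ n (λ k → entry k l * a l) ≡ (sgn n * a l) * δ n l
  collect l = trans (Σ-scaleʳ n (a l) (λ k → entry k l))
    (trans (cong (_* a l) (alternating-δ n l))
      (solve 3 (λ s d x → (s :* d) :* x := (s :* x) :* d) refl (sgn n) (δ n l) (a l)))

length-bernList : ∀ n → length (bernList n) ≡ n
length-bernList zero = refl
length-bernList (suc n) =
  trans (length-++ (bernList n)) (trans (cong (ℕ._+ 1) (length-bernList n)) (ℕP.+-comm n 1))

at-++ˡ : ∀ (xs ys : List ℚ) k → k < length xs → at (xs ++ ys) k ≡ at xs k
at-++ˡ (x ∷ xs) ys zero _ = refl
at-++ˡ (x ∷ xs) ys (suc k) (s≤s k<) = at-++ˡ xs ys k k<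

at-last : ∀ (xs : List ℚ) y m → length xs ≡ m → at (xs ++ [ y ]) m ≡ y
at-last [] y .0 refl = refl
at-last (x ∷ xs) y .(suc (length xs)) refl = at-last xs y (length xs) refl

at-bernList : ∀ n k → k < n → at (bernList n) k ≡ bern k
at-bernList (suc n) k k<1+n with ℕP.m≤n⇒m<n∨m≡n (ℕP.≤-pred k<1+n)
... | inj₁ k<n = trans (at-++ˡ (bernList n) _ k (subst (k <_) (sym (length-bernList n)) k<n))
                       (at-bernList n k k<n)
... | inj₂ refl = refl

bern-suc : ∀ n → bern (suc n) ≡ - ((ℤ.+ 1 / suc (suc n))
  * Σ< (suc n) (λ k → ℕ→ℚ (suc (suc n) C k) * at (bernList (suc n)) k))
bern-suc n = at-last (bernList (suc n)) _ (suc n) (length-bernList (suc n))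

recurrenceSum : (ℕ → ℚ) → ℕ → ℚ
recurrenceSum X n = Σ≤ n (λ k → ℕ→ℚ (suc n C k) * X k)

bern-recurrence : ∀ n → recurrenceSum bern n ≡ δ 0 n
bern-recurrence zero = refl
bern-recurrence (suc n) = begin
  S + ℕ→ℚ (suc (suc n) C suc n) * bern (suc n)
    ≡⟨ cong₂ (λ c b → S + ℕ→ℚ c * b) (C-[1+n]-n (suc n)) (bern-suc n) ⟩
  S + c * - (c⁻¹ * Σ< (suc n) (λ k → ℕ→ℚ (suc (suc n) C k) * at (bernList (suc n)) k))
    ≡⟨ cong (λ x → S + c * - (c⁻¹ * x)) (trans (Σ<⇒Σ≤ n _)
          (Σ-cong n (λ k k≤n → cong (ℕ→ℚ (suc (suc n) C k) *_) (at-bernList (suc n) k (s≤s k≤n))))) ⟩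
  S + c * - (c⁻¹ * S)   ≡⟨ solve 3 (λ s c i → s :+ c :* (:- (i :* s)) := s :+ (:- ((c :* i) :* s))) refl S c c⁻¹ ⟩
  S + - ((c * c⁻¹) * S) ≡⟨ cong (λ x → S + - (x * S)) (ℕ→ℚ-inverse (suc n)) ⟩
  S + - (1ℚ * S)        ≡⟨ solve 1 (λ s → s :+ (:- (con 1ℚ :* s)) := con 0ℚ) refl S ⟩
  0ℚ                    ∎
  where
  S = Σ≤ n (λ k → ℕ→ℚ (suc (suc n) C k) * bern k)
  c = ℕ→ℚ (suc (suc n))
  c⁻¹ = ℤ.+ 1 / suc (suc n)

-- The recurrence determines a sequence uniquely: the n-th equation has
-- leading term C(n+1,n) X_n = (n+1) X_n, so X_n is determined by X_0 … X_{n-1}.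
recurrence-unique : ∀ X Y → (∀ n → recurrenceSum X n ≡ recurrenceSum Y n) → ∀ n → X n ≡ Y n
recurrence-unique X Y same = <-rec (λ n → X n ≡ Y n) step
  where
  step : ∀ n → (∀ {k} → k < n → X k ≡ Y k) → X n ≡ Y n
  step zero _ = trans (sym (*-identityˡ (X 0))) (trans (same 0) (*-identityˡ (Y 0)))
  step (suc n) earlier = ℕ→ℚ-cancel (suc n) (begin
    ℕ→ℚ (suc (suc n)) * X (suc n)   ≡⟨ cong (λ c → ℕ→ℚ c * X (suc n)) (sym (C-[1+n]-n (suc n))) ⟩
    leading X                       ≡⟨ ∙-cancelˡ (lower X) (leading X) (leading Y)
                                         (trans (same (suc n)) (cong (_+ leading Y) (sym lower-agree))) ⟩
    leading Y                       ≡⟨ cong (λ c → ℕ→ℚ c * Y (suc n)) (C-[1+n]-n (suc n)) ⟩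
    ℕ→ℚ (suc (suc n)) * Y (suc n)   ∎)
    where
    lower leading : (ℕ → ℚ) → ℚ
    lower Z = Σ≤ n (λ k → ℕ→ℚ (suc (suc n) C k) * Z k)
    leading Z = ℕ→ℚ (suc (suc n) C suc n) * Z (suc n)
    lower-agree : lower X ≡ lower Y
    lower-agree = Σ-cong n (λ k k≤n → cong (ℕ→ℚ (suc (suc n) C k) *_) (earlier (s≤s k≤n)))

binomialTransform-suc : ∀ X n → binomialTransform X (suc n) ≡ recurrenceSum X n + X (suc n)
binomialTransform-suc X n = cong (recurrenceSum X n +_)
  (trans (cong (λ c → ℕ→ℚ c * X (suc n)) (nCn≡1 (suc n))) (*-identityˡ (X (suc n))))

-- The sequence  Y_k = (-1)^k Σ_r C(k,r) B_r  satisfies the Bernoulli recurrence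
-- (by binomial inversion), hence Y = B.
bern-reflection : ∀ d → binomialTransform bern d ≡ sgn d * bern d
bern-reflection d = begin
  binomialTransform bern d              ≡⟨ sym (*-identityˡ _) ⟩
  1ℚ * binomialTransform bern d         ≡⟨ cong (_* binomialTransform bern d) (sym (sgn² d)) ⟩
  (sgn d * sgn d) * binomialTransform bern d
    ≡⟨ *-assoc (sgn d) (sgn d) _ ⟩
  sgn d * Y d                           ≡⟨ cong (sgn d *_) (recurrence-unique Y bern Y-recurrence d) ⟩
  sgn d * bern d                        ∎
  where
  Y : ℕ → ℚ
  Y k = sgn k * binomialTransform bern k
  Y-recurrence : ∀ n → recurrenceSum Y n ≡ recurrenceSum bern n
  Y-recurrence n = begin
    recurrenceSum Y n
      ≡⟨ solve 2 (λ r y → r := (r :+ y) :+ (:- y)) refl (recurrenceSum Y n) (Y (suc n)) ⟩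
    (recurrenceSum Y n + Y (suc n)) + - Y (suc n)
      ≡⟨ cong (_+ - Y (suc n)) (sym (binomialTransform-suc Y n)) ⟩
    binomialTransform Y (suc n) + - Y (suc n)
      ≡⟨ cong (_+ - Y (suc n)) (binomial-inversion bern (suc n)) ⟩
    sgn (suc n) * bern (suc n) + - (sgn (suc n) * binomialTransform bern (suc n))
      ≡⟨ cong (λ x → sgn (suc n) * bern (suc n) + - (sgn (suc n) * x)) (binomialTransform-suc bern n) ⟩
    sgn (suc n) * bern (suc n) + - (sgn (suc n) * (recurrenceSum bern n + bern (suc n)))
      ≡⟨ solve 3 (λ s b r → (:- s) :* b :+ (:- ((:- s) :* (r :+ b))) := s :* r) refl
           (sgn n) (bern (suc n)) (recurrenceSum bern n) ⟩
    sgn n * recurrenceSum bern n        ≡⟨ cong (sgn n *_) (bern-recurrence n) ⟩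
    sgn n * δ 0 n                       ≡⟨ sign-irrelevant n ⟩
    δ 0 n                               ≡⟨ sym (bern-recurrence n) ⟩
    recurrenceSum bern n                ∎
    where
    sign-irrelevant : ∀ n → sgn n * δ 0 n ≡ δ 0 n
    sign-irrelevant zero = refl
    sign-irrelevant (suc n) = *-zeroʳ (sgn (suc n))

-- Bernoulli polynomials.

-- The coefficient of x^i in B_N(x) is C(N,i) B_{N-i} for i ≤ N and 0 otherwise.
-- (The binomial coefficient itself tests i ≤ᵇ N, which the case split also
-- rewrites; `eq` restores it.)
bernPoly-≤ : ∀ {N i} → i ≤ N → bernPoly N i ≡ ℕ→ℚ (N C i) * bern (N ℕ.∸ i)
bernPoly-≤ {N} {i} i≤N with i ℕ.≤ᵇ N in eq
... | true = cong (λ b → ℕ→ℚ (if b then N C′ (i ℕ.⊓ (N ℕ.∸ i)) else 0) * bern (N ℕ.∸ i)) eq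
... | false = contradiction (subst T eq (ℕP.≤⇒≤ᵇ i≤N)) (λ ())

bernPoly-> : ∀ {N i} → N < i → bernPoly N i ≡ 0ℚ
bernPoly-> {N} {i} N<i with i ℕ.≤ᵇ N in eq
... | true = contradiction (ℕP.≤ᵇ⇒≤ i N (subst T (sym eq) _)) (ℕP.<⇒≱ N<i)
... | false = refl

scaled-bernPoly-> : ∀ c {k i} → k < i → c * bernPoly k i ≡ 0ℚ
scaled-bernPoly-> c k<i = trans (cong (c *_) (bernPoly-> k<i)) (*-zeroʳ c)

bernPoly-coeff : ∀ i d → bernPoly (i ℕ.+ d) i ≡ ℕ→ℚ ((i ℕ.+ d) C i) * bern d
bernPoly-coeff i d = trans (bernPoly-≤ (ℕP.m≤m+n i d))
  (cong (λ x → ℕ→ℚ ((i ℕ.+ d) C i) * bern x) (ℕP.m+n∸m≡n i d))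

-- Coefficient i of  Σ_k C(i+d,k) B_k(x)  is C(i+d,i) (-1)^d B_d: only k ≥ i
-- contribute, and the subset identity reduces the sum to bern-reflection.
bernPoly-shift-≤ : ∀ i d → Σ≤ (i ℕ.+ d) (λ k → ℕ→ℚ ((i ℕ.+ d) C k) * bernPoly k i)
                             ≡ sgn d * bernPoly (i ℕ.+ d) i
bernPoly-shift-≤ i d = begin
  Σ≤ (i ℕ.+ d) (λ k → ℕ→ℚ ((i ℕ.+ d) C k) * bernPoly k i)
    ≡⟨ Σ-drop i d (λ k → scaled-bernPoly-> (ℕ→ℚ ((i ℕ.+ d) C k))) ⟩
  Σ≤ d (λ r → ℕ→ℚ ((i ℕ.+ d) C (i ℕ.+ r)) * bernPoly (i ℕ.+ r) i)
    ≡⟨ Σ-cong d (λ r _ → term r) ⟩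
  Σ≤ d (λ r → C-id * (ℕ→ℚ (d C r) * bern r))
    ≡⟨ Σ-scale d C-id _ ⟩
  C-id * binomialTransform bern d    ≡⟨ cong (C-id *_) (bern-reflection d) ⟩
  C-id * (sgn d * bern d)            ≡⟨ solve 3 (λ c s b → c :* (s :* b) := s :* (c :* b)) refl C-id (sgn d) (bern d) ⟩
  sgn d * (C-id * bern d)            ≡⟨ cong (sgn d *_) (sym (bernPoly-coeff i d)) ⟩
  sgn d * bernPoly (i ℕ.+ d) i       ∎
  where
  C-id = ℕ→ℚ ((i ℕ.+ d) C i)
  term : ∀ r → ℕ→ℚ ((i ℕ.+ d) C (i ℕ.+ r)) * bernPoly (i ℕ.+ r) i ≡ C-id * (ℕ→ℚ (d C r) * bern r)
  term r = begin
    ℕ→ℚ ((i ℕ.+ d) C (i ℕ.+ r)) * bernPoly (i ℕ.+ r) i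
      ≡⟨ cong (ℕ→ℚ ((i ℕ.+ d) C (i ℕ.+ r)) *_) (bernPoly-coeff i r) ⟩
    ℕ→ℚ ((i ℕ.+ d) C (i ℕ.+ r)) * (ℕ→ℚ ((i ℕ.+ r) C i) * bern r)
      ≡⟨ sym (*-assoc (ℕ→ℚ ((i ℕ.+ d) C (i ℕ.+ r))) (ℕ→ℚ ((i ℕ.+ r) C i)) (bern r)) ⟩
    (ℕ→ℚ ((i ℕ.+ d) C (i ℕ.+ r)) * ℕ→ℚ ((i ℕ.+ r) C i)) * bern r
      ≡⟨ cong (_* bern r) (trans (sym (ℕ→ℚ-* ((i ℕ.+ d) C (i ℕ.+ r)) ((i ℕ.+ r) C i)))
           (trans (cong ℕ→ℚ (subset-of-subset i d r)) (ℕ→ℚ-* ((i ℕ.+ d) C i) (d C r)))) ⟩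
    (C-id * ℕ→ℚ (d C r)) * bern r     ≡⟨ *-assoc C-id (ℕ→ℚ (d C r)) (bern r) ⟩
    C-id * (ℕ→ℚ (d C r) * bern r)     ∎

bernPoly-shift : ∀ N i → ΣP≤ N (λ k → ℕ→ℚ (N C k) · bernPoly k) i ≡ (sgn N · neg-x (bernPoly N)) i
bernPoly-shift N i with ℕP.≤-<-connex i N
... | inj₂ N<i = begin
  Σ≤ N (λ k → ℕ→ℚ (N C k) * bernPoly k i)
    ≡⟨ Σ-zero N (λ k k≤N → scaled-bernPoly-> (ℕ→ℚ (N C k)) (ℕP.≤-<-trans k≤N N<i)) ⟩
  0ℚ                                  ≡⟨ sym (scaled-bernPoly-> (sgn N * sgn i) N<i) ⟩
  (sgn N * sgn i) * bernPoly N i      ≡⟨ *-assoc (sgn N) (sgn i) (bernPoly N i) ⟩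
  sgn N * (sgn i * bernPoly N i)      ∎
... | inj₁ i≤N with ℕP.m≤n⇒∃[o]m+o≡n i≤N
...   | d , refl = begin
  Σ≤ (i ℕ.+ d) (λ k → ℕ→ℚ ((i ℕ.+ d) C k) * bernPoly k i)
                                      ≡⟨ bernPoly-shift-≤ i d ⟩
  sgn d * b                           ≡⟨ cong (_* b) (sym (sgn-cancel i d)) ⟩
  (sgn (i ℕ.+ d) * sgn i) * b         ≡⟨ *-assoc (sgn (i ℕ.+ d)) (sgn i) b ⟩
  sgn (i ℕ.+ d) * (sgn i * b)         ∎
  where b = bernPoly (i ℕ.+ d) i

NB-binomial : ∀ N i → ΣP≤ (suc N) (λ k → ℕ→ℚ (suc N C k) · NB k) i
                       ≡ (ℕ→ℚ (suc N) · ΣP≤ N (λ k → ℕ→ℚ (N C k) · bernPoly k)) i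
NB-binomial N i = begin
  Σ≤ (suc N) (λ k → ℕ→ℚ (suc N C k) * NB k i)
    ≡⟨ Σ-shift N _ ⟩
  ℕ→ℚ 1 * 0ℚ + Σ≤ N (λ k → ℕ→ℚ (suc N C suc k) * (ℕ→ℚ (suc k) * bernPoly k i))
    ≡⟨ cong₂ _+_ (*-zeroʳ (ℕ→ℚ 1)) (Σ-cong N (λ k _ → term k)) ⟩
  0ℚ + Σ≤ N (λ k → ℕ→ℚ (suc N) * (ℕ→ℚ (N C k) * bernPoly k i))
    ≡⟨ trans (+-identityˡ _) (Σ-scale N (ℕ→ℚ (suc N)) _) ⟩
  ℕ→ℚ (suc N) * Σ≤ N (λ k → ℕ→ℚ (N C k) * bernPoly k i) ∎
  where
  term : ∀ k → ℕ→ℚ (suc N C suc k) * (ℕ→ℚ (suc k) * bernPoly k i)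
             ≡ ℕ→ℚ (suc N) * (ℕ→ℚ (N C k) * bernPoly k i)
  term k = begin
    c * (ℕ→ℚ (suc k) * b)               ≡⟨ solve 3 (λ c m b → c :* (m :* b) := (m :* c) :* b) refl c (ℕ→ℚ (suc k)) b ⟩
    (ℕ→ℚ (suc k) * c) * b               ≡⟨ cong (_* b) (absorptionℚ N k) ⟩
    (ℕ→ℚ (suc N) * ℕ→ℚ (N C k)) * b     ≡⟨ *-assoc (ℕ→ℚ (suc N)) (ℕ→ℚ (N C k)) b ⟩
    ℕ→ℚ (suc N) * (ℕ→ℚ (N C k) * b)     ∎
    where
    c = ℕ→ℚ (suc N C suc k)
    b = bernPoly k i

NB-reflection : ∀ i a → NB a i ≡ - sgn a * Σ≤ a (λ k → ℕ→ℚ (a C k) * neg-x (NB k) i)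
NB-reflection i zero = solve 1 (λ s → con 0ℚ := :- (con 1ℚ) :* (con 1ℚ :* (s :* con 0ℚ))) refl (sgn i)
NB-reflection i (suc N) = sym (begin
  - sgn (suc N) * Σ≤ (suc N) (λ k → ℕ→ℚ (suc N C k) * (sgn i * NB k i))
    ≡⟨ cong (- sgn (suc N) *_) (trans (Σ-cong (suc N) (λ k _ → commute k)) (Σ-scale (suc N) (sgn i) _)) ⟩
  - sgn (suc N) * (sgn i * Σ≤ (suc N) (λ k → ℕ→ℚ (suc N C k) * NB k i))
    ≡⟨ cong (λ x → - sgn (suc N) * (sgn i * x)) (NB-binomial N i) ⟩
  - sgn (suc N) * (sgn i * (ℕ→ℚ (suc N) * Σ≤ N (λ k → ℕ→ℚ (N C k) * bernPoly k i)))
    ≡⟨ cong (λ x → - sgn (suc N) * (sgn i * (ℕ→ℚ (suc N) * x))) (bernPoly-shift N i) ⟩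
  - sgn (suc N) * (sgn i * (ℕ→ℚ (suc N) * (sgn N * (sgn i * bernPoly N i))))
    ≡⟨ solve 4 (λ s t n b → :- (:- s) :* (t :* (n :* (s :* (t :* b)))) := (s :* s) :* ((t :* t) :* (n :* b)))
         refl (sgn N) (sgn i) (ℕ→ℚ (suc N)) (bernPoly N i) ⟩
  (sgn N * sgn N) * ((sgn i * sgn i) * (ℕ→ℚ (suc N) * bernPoly N i))
    ≡⟨ cong₂ (λ x y → x * (y * (ℕ→ℚ (suc N) * bernPoly N i))) (sgn² N) (sgn² i) ⟩
  1ℚ * (1ℚ * (ℕ→ℚ (suc N) * bernPoly N i))
    ≡⟨ trans (*-identityˡ _) (*-identityˡ _) ⟩
  ℕ→ℚ (suc N) * bernPoly N i ∎)
  where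
  commute : ∀ k → ℕ→ℚ (suc N C k) * (sgn i * NB k i) ≡ sgn i * (ℕ→ℚ (suc N C k) * NB k i)
  commute k = solve 3 (λ c s x → c :* (s :* x) := s :* (c :* x)) refl (ℕ→ℚ (suc N C k)) (sgn i) (NB k i)

-- Propagation along Pascal's rule.

shiftedSum : ℕ → (ℕ → ℚ) → ℕ → ℚ
shiftedSum M f a = Σ≤ M (λ j → ℕ→ℚ (M C j) * f (a ℕ.+ j))

shiftedSum-step : ∀ M f a → shiftedSum (suc M) f a ≡ shiftedSum M f a + shiftedSum M f (suc a)
shiftedSum-step M f a = trans (pascalΣ M (λ j → f (a ℕ.+ j)))
  (cong (shiftedSum M f a +_) (Σ-cong M (λ j _ → cong (λ x → ℕ→ℚ (M C j) * f x) (ℕP.+-suc a j))))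

-- If P(a) = -(-1)^a S[a, Q, 0] for all a, then for all M, a
--   S[M, P, a] = -(-1)^{M+a} S[a, Q, M].
-- Induction on M: both sides obey Pascal's rule, in the roles of M and a swapped.
reflection-propagates : ∀ (P Q : ℕ → ℚ) → (∀ a → P a ≡ - sgn a * shiftedSum a Q 0) →
  ∀ M a → shiftedSum M P a ≡ - sgn (M ℕ.+ a) * shiftedSum a Q M
reflection-propagates P Q base zero a =
  trans (*-identityˡ (P (a ℕ.+ 0))) (trans (cong P (ℕP.+-identityʳ a)) (base a))
reflection-propagates P Q base (suc M) a = begin
  shiftedSum (suc M) P a                             ≡⟨ shiftedSum-step M P a ⟩
  shiftedSum M P a + shiftedSum M P (suc a)          ≡⟨ cong₂ _+_ (IH a) (IH (suc a)) ⟩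
  - s * S₀ + - sgn (M ℕ.+ suc a) * shiftedSum (suc a) Q M
    ≡⟨ cong₂ (λ x y → - s * S₀ + - x * y) (cong sgn (ℕP.+-suc M a)) (shiftedSum-step a Q M) ⟩
  - s * S₀ + - - s * (S₀ + S₁)
    ≡⟨ solve 3 (λ s t u → :- s :* t :+ :- :- s :* (t :+ u) := :- (:- s) :* u) refl s S₀ S₁ ⟩
  - sgn (suc M ℕ.+ a) * S₁                            ∎
  where
  IH = reflection-propagates P Q base M
  s = sgn (M ℕ.+ a)
  S₀ = shiftedSum a Q M
  S₁ = shiftedSum a Q (suc M)

theorem1p6 : (q m n : ℕ) → 0 < m ℕ.+ n → (i : ℕ) →
    ΣP≤ (m ℕ.+ q) (λ j → ℕ→ℚ ((m ℕ.+ q) C j) · NB (n ℕ.+ q ℕ.+ j)) i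
      ≡ ((- sgn (m ℕ.+ n)) · ΣP≤ (n ℕ.+ q) (λ k → ℕ→ℚ ((n ℕ.+ q) C k) · neg-x (NB (m ℕ.+ q ℕ.+ k)))) i
theorem1p6 q m n _ i = begin
  shiftedSum (m ℕ.+ q) P (n ℕ.+ q)
    ≡⟨ reflection-propagates P Q (NB-reflection i) (m ℕ.+ q) (n ℕ.+ q) ⟩
  - sgn (m ℕ.+ q ℕ.+ (n ℕ.+ q)) * shiftedSum (n ℕ.+ q) Q (m ℕ.+ q)
    ≡⟨ cong (λ s → - s * shiftedSum (n ℕ.+ q) Q (m ℕ.+ q)) (sgn-parity m n q) ⟩
  - sgn (m ℕ.+ n) * shiftedSum (n ℕ.+ q) Q (m ℕ.+ q) ∎
  where
  P Q : ℕ → ℚ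
  P N = NB N i
  Q N = neg-x (NB N) i
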